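{- Let $S$ be a sticky tree with $n+1$ nodes. Then $\mathrm{D}(S)$ and $\mathrm{E}(S)$ are Dyck paths of length $2n$ and $\ell_{\mathrm{D}(S)}(i)\le \ell_{\mathrm{E}(S)}(i)$ for all $1\le i\le n$; that is, $\mathrm{I}(S)=[\mathrm{D}(S),\mathrm{E}(S)]$ is an interval of the Tamari lattice of order $n$.
   Context: Plane trees, prefix order (root, then the children's subtrees left to right), depth (root depth $0$), $S_w$ = subtree rooted at $w$. A sticky tree is a plane tree with $\ell:V\to\mathbb{N}$ such that (1) $0\le\ell(w)\le$ depth$(w)$; (2) every node $w$ of depth $d>0$ has some $z\in S_w$ (possibly $w$) with $\ell(z)<d$; (3) for every node $w$ of depth $d$, if some $z\in S_w$ has $\ell(z)=d$, then every node of $S_w$ (including $w$) preceding $z$ in prefix order has label $\ge d$. The certificate of a non-root node $w$ of depth $d$ is the first node of $S_w$ in prefix order with label $<d$. The certificate-counting function $c$ assigns to each node $w$ the number of nodes whose certificate is $w$. A Dyck path is a word in up steps $u$ and down steps $d$ that, read as a lattice path with steps $(1,1)$ and $(1,-1)$, starts and ends on the $x$-axis and never goes below it. In a Dyck path $D$, the $i$-th up step is matched with the down step $d_j$ such that the factor $D_i$ strictly between them is a Dyck path; $\ell_D(i)$ is the length of $D_i$. The Tamari lattice of order $n$ is the partial order on Dyck paths of length $2n$ with $D\preceq E$ iff $\ell_D(i)\le\ell_E(i)$ for all $1\le i\le n$; a pair $[D,E]$ with $D\preceq E$ is an interval. $\mathrm{E}(S)$ is the Dyck path recording the depth variations of a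 (counter-clockwise, i.e. left-to-right) contour traversal of $S$ (an up step when going from a node to a child, a down step when returning to the parent). If $v_1,\dots,v_n$ are the non-root nodes of $S$ in prefix order, $\mathrm{D}(S)=u\,d^{c(v_1)}\,u\,d^{c(v_2)}\cdots u\,d^{c(v_n)}$. -}

module Defs where

open import Data.Nat using (ℕ; zero; suc; _+_; _*_; _∸_; _≤_; _<_)
open import Data.Nat.Properties using (_≟_)
open import Data.List using (List; []; _∷_; _++_; length; replicate)
open import Data.List.Relation.Unary.All using (All)
open import Data.List.Relation.Unary.Any using (Any)
open import Data.Maybe using (Maybe; just; nothing)
open import Data.Product using (_×_; _,_)
open import Data.Empty using (⊥)
open import Relation.Binary.PropositionalEquality using (_≡_)
open import Relation.Nullary using (yes; no)

data LTree : Set where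
  node : ℕ → List LTree → LTree

rootLabel : LTree → ℕ
rootLabel (node l _) = l

mutual
  labels : LTree → List ℕ
  labels (node l ts) = l ∷ labelsF ts

  labelsF : List LTree → List ℕ
  labelsF []       = []
  labelsF (t ∷ ts) = labels t ++ labelsF ts

size : LTree → ℕ
size t = length (labels t)

mutual
  -- all nodes w in prefix order, each given as (depth(w) , S_w),
  -- the first argument being the depth of the root of the tree
  subs : ℕ → LTree → List (ℕ × LTree)
  subs d (node l ts) = (d , node l ts) ∷ subsF (suc d) ts

  subsF : ℕ → List LTree → List (ℕ × LTree)
  subsF d []       = []
  subsF d (t ∷ ts) = subs d t ++ subsF d ts

nodes : LTree → List (ℕ × LTree)
nodes S = subs 0 S

StickyAt : ℕ × LTree → Set
StickyAt (d , t) =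
  (rootLabel t ≤ d)
  × (0 < d → Any (λ z → z < d) (labels t))
  × (∀ xs z ys → labels t ≡ xs ++ z ∷ ys → z ≡ d → All (λ x → d ≤ x) xs)

Sticky : LTree → Set
Sticky S = All StickyAt (nodes S)

-- Certificates and the certificate-counting function.
-- Nodes are identified by their index in prefix order (root = 0).

firstBelow : ℕ → List ℕ → Maybe ℕ
firstBelow d [] = nothing
firstBelow d (x ∷ xs) with suc x Data.Nat.≤? d
... | yes _ = just 0
... | no  _ = Data.Maybe.map suc (firstBelow d xs)

-- certificates (as prefix indices) of a list of nodes whose first
-- element has prefix index i
certsFrom : ℕ → List (ℕ × LTree) → List (Maybe ℕ)
certsFrom i [] = []
certsFrom i ((d , t) ∷ r) =
  Data.Maybe.map (i +_) (firstBelow d (labels t)) ∷ certsFrom (suc i) r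

tail' : ∀ {A : Set} → List A → List A
tail' []       = []
tail' (_ ∷ xs) = xs

certificates : LTree → List (Maybe ℕ)
certificates S = certsFrom 1 (tail' (nodes S))

countJust : ℕ → List (Maybe ℕ) → ℕ
countJust j [] = 0
countJust j (nothing ∷ ms) = countJust j ms
countJust j (just k ∷ ms) with k ≟ j
... | yes _ = suc (countJust j ms)
... | no  _ = countJust j ms

cert-count : LTree → ℕ → ℕ
cert-count S j = countJust j (certificates S)

data Step : Set where
  u d : Step

DyckFrom : ℕ → List Step → Set
DyckFrom h [] = h ≡ 0
DyckFrom h (u ∷ w) = DyckFrom (suc h) w
DyckFrom zero (d ∷ w) = ⊥
DyckFrom (suc h) (d ∷ w) = DyckFrom h w

IsDyck : List Step → Set
IsDyck w = DyckFrom 0 w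

-- suffix following the i-th up step (i ≥ 1)
afterUp : ℕ → List Step → List Step
afterUp i [] = []
afterUp i (d ∷ w) = afterUp i w
afterUp zero (u ∷ w) = []
afterUp (suc zero) (u ∷ w) = w
afterUp (suc (suc i)) (u ∷ w) = afterUp (suc i) w

-- length of the longest prefix that does not go below its starting
-- height before the matching down step, i.e. the length of the factor
-- strictly between an up step and its matched down step
matchedLen : ℕ → List Step → ℕ
matchedLen h [] = 0
matchedLen h (u ∷ w) = suc (matchedLen (suc h) w)
matchedLen zero (d ∷ w) = 0
matchedLen (suc h) (d ∷ w) = suc (matchedLen h w)

ℓ : List Step → ℕ → ℕ
ℓ D i = matchedLen 0 (afterUp i D)

TamariLe : ℕ → List Step → List Step → Set
TamariLe n D E =
  (IsDyck D × length D ≡ 2 * n) × (IsDyck E × length E ≡ 2 * n)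
  × (∀ i → 1 ≤ i → i ≤ n → ℓ D i ≤ ℓ E i)

TamariInterval : ℕ → List Step → List Step → Set
TamariInterval = TamariLe

mutual
  contour : LTree → List Step
  contour (node _ ts) = contourF ts

  contourF : List LTree → List Step
  contourF [] = []
  contourF (t ∷ ts) = u ∷ contour t ++ d ∷ contourF ts

E-path : LTree → List Step
E-path S = contour S

D-from : LTree → ℕ → ℕ → List Step
D-from S j zero = []
D-from S j (suc k) = u ∷ replicate (cert-count S j) d ++ D-from S (suc j) k

D-path : LTree → List Step
D-path S = D-from S 1 (size S ∸ 1)

-- Only condition (2) of stickiness is needed: it puts the certificate of every non-root node w
-- inside S_w, so the certificate of the i-th non-root node v_i has prefix index in [i, i + |S_{v_i}|).
-- In D(S) the down steps after the j-th up step count the certificates equal to v_j. Hence at most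
-- i down steps precede the (i+1)-th up step, n occur in all (so D(S) is a Dyck path), and the
-- |S_{v_i}| up steps starting with the i-th one come with at least |S_{v_i}| down steps, so the i-th
-- up step is matched within 2(|S_{v_i}| - 1) steps. In the contour E(S) the i-th up step enters v_i
-- and is matched exactly after the contour of S_{v_i}, of length 2(|S_{v_i}| - 1).
module Submission where

open import Defs
open import Data.Nat using (ℕ; zero; suc; _+_; _*_; _∸_; _≤_; _<_; z≤n; s≤s; _≤?_; _<?_)
open import Data.Nat.Properties
open import Algebra.Properties.CommutativeSemigroup +-commutativeSemigroup using (x∙yz≈y∙xz; interchange)
open import Data.Nat.Tactic.RingSolver using (solve-∀)
open import Data.List using (List; []; _∷_; _++_; length; replicate)
open import Data.List.Properties using (length-++; ++-assoc; length-replicate; ++-identityʳ)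
open import Data.List.Relation.Unary.All as All using (All; []; _∷_)
open import Data.List.Relation.Unary.All.Properties using (++⁺; ++⁻ˡ; ++⁻ʳ)
open import Data.List.Relation.Unary.Any using (Any; here; there)
open import Data.Maybe using (Maybe; just; nothing)
import Data.Maybe.Relation.Unary.All as MaybeAll
import Data.Maybe.Relation.Unary.All.Properties as MaybeAll
import Data.Maybe.Relation.Unary.Any as MaybeAny
open import Data.Product using (_×_; _,_)
open import Data.Unit using (⊤; tt)
open import Function using (_∘_)
open import Relation.Binary.PropositionalEquality
open import Relation.Unary using (_⊆_)
open import Relation.Nullary using (yes; no; contradiction)

sumFrom : (ℕ → ℕ) → ℕ → ℕ → ℕ
sumFrom f j zero    = 0
sumFrom f j (suc k) = f j + sumFrom f (suc j) k

staircase : (ℕ → ℕ) → ℕ → ℕ → List Step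
staircase f j zero    = []
staircase f j (suc k) = u ∷ replicate (f j) d ++ staircase f (suc j) k

D-from≡staircase : ∀ S j k → D-from S j k ≡ staircase (cert-count S) j k
D-from≡staircase S j zero    = refl
D-from≡staircase S j (suc k) =
  cong (λ w → u ∷ replicate (cert-count S j) d ++ w) (D-from≡staircase S (suc j) k)

length-staircase : ∀ f j k → length (staircase f j k) ≡ k + sumFrom f j k
length-staircase f j zero    = refl
length-staircase f j (suc k) = cong suc (begin
  length (replicate (f j) d ++ staircase f (suc j) k)
    ≡⟨ length-++ (replicate (f j) d) ⟩
  length (replicate (f j) d) + length (staircase f (suc j) k)
    ≡⟨ cong₂ _+_ (length-replicate (f j)) (length-staircase f (suc j) k) ⟩
  f j + (k + sumFrom f (suc j) k)
    ≡⟨ x∙yz≈y∙xz (f j) k _ ⟩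
  k + (f j + sumFrom f (suc j) k)
    ∎)
  where open ≡-Reasoning

staircase-++ : ∀ f j a b → staircase f j (a + b) ≡ staircase f j a ++ staircase f (a + j) b
staircase-++ f j zero    b = refl
staircase-++ f j (suc a) b = cong (u ∷_) (begin
  replicate (f j) d ++ staircase f (suc j) (a + b)
    ≡⟨ cong (replicate (f j) d ++_) (staircase-++ f (suc j) a b) ⟩
  replicate (f j) d ++ staircase f (suc j) a ++ staircase f (a + suc j) b
    ≡⟨ cong (λ i → replicate (f j) d ++ staircase f (suc j) a ++ staircase f i b) (+-suc a j) ⟩
  replicate (f j) d ++ staircase f (suc j) a ++ staircase f (suc a + j) b
    ≡⟨ ++-assoc (replicate (f j) d) _ _ ⟨
  (replicate (f j) d ++ staircase f (suc j) a) ++ staircase f (suc a + j) b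
    ∎)
  where open ≡-Reasoning

DyckFrom-replicate-d : ∀ m {h} w → DyckFrom h w → DyckFrom (m + h) (replicate m d ++ w)
DyckFrom-replicate-d zero    w dyck = dyck
DyckFrom-replicate-d (suc m) w dyck = DyckFrom-replicate-d m w dyck

staircase-DyckFrom : ∀ f j k h → (∀ i → sumFrom f j i ≤ h + i) → sumFrom f j k ≡ h + k →
  DyckFrom h (staircase f j k)
staircase-DyckFrom f j zero    h bounded total = sym (trans total (+-identityʳ h))
staircase-DyckFrom f j (suc k) h bounded total =
  subst (λ g → DyckFrom g (replicate (f j) d ++ staircase f (suc j) k)) f[j]+h′≡1+h
    (DyckFrom-replicate-d (f j) _
      (staircase-DyckFrom f (suc j) k h′ bounded′
        (+-cancelˡ-≡ (f j) _ _ (trans total (shift k)))))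
  where
  f[j]≤1+h : f j ≤ suc h
  f[j]≤1+h = subst₂ _≤_ (+-identityʳ (f j)) (+-comm h 1) (bounded 1)
  h′ : ℕ
  h′ = suc h ∸ f j
  f[j]+h′≡1+h : f j + h′ ≡ suc h
  f[j]+h′≡1+h = m+[n∸m]≡n f[j]≤1+h
  shift : ∀ i → h + suc i ≡ f j + (h′ + i)
  shift i = trans (+-suc h i) (trans (cong (_+ i) (sym f[j]+h′≡1+h)) (+-assoc (f j) h′ i))
  bounded′ : ∀ i → sumFrom f (suc j) i ≤ h′ + i
  bounded′ i = +-cancelˡ-≤ (f j) _ _ (≤-trans (bounded (suc i)) (≤-reflexive (shift i)))

afterUp-replicate-d : ∀ i m w → afterUp i (replicate m d ++ w) ≡ afterUp i w
afterUp-replicate-d i zero    w = refl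
afterUp-replicate-d i (suc m) w = afterUp-replicate-d i m w

afterUp-staircase : ∀ f j p k →
  afterUp (suc p) (staircase f j (suc p + k)) ≡ replicate (f (j + p)) d ++ staircase f (suc (j + p)) k
afterUp-staircase f j zero    k rewrite +-identityʳ j = refl
afterUp-staircase f j (suc p) k = begin
  afterUp (suc p) (replicate (f j) d ++ staircase f (suc j) (suc p + k))
    ≡⟨ afterUp-replicate-d (suc p) (f j) _ ⟩
  afterUp (suc p) (staircase f (suc j) (suc p + k))
    ≡⟨ afterUp-staircase f (suc j) p k ⟩
  replicate (f (suc j + p)) d ++ staircase f (suc (suc j + p)) k
    ≡⟨ cong (λ i → replicate (f i) d ++ staircase f (suc i) k) (+-suc j p) ⟨
  replicate (f (j + suc p)) d ++ staircase f (suc (j + suc p)) k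
    ∎
  where open ≡-Reasoning

-- Once the down steps outnumber height plus up steps, the path has dropped below its start.
matchedLen-staircase : ∀ f k a h j r → suc (h + k) ≤ a + sumFrom f j k →
  matchedLen h (replicate a d ++ staircase f j k ++ r) ≤ h + (k + k)
matchedLen-staircase f k       (suc a) (suc h) j r (s≤s deficit) = s≤s (matchedLen-staircase f k a h j r deficit)
matchedLen-staircase f k       (suc a) zero    j r _             = z≤n
matchedLen-staircase f zero    zero    h       j r ()
matchedLen-staircase f (suc k) zero    h       j r deficit
  rewrite ++-assoc (replicate (f j) d) (staircase f (suc j) k) r =
  ≤-trans (s≤s (matchedLen-staircase f k (f j) (suc h) (suc j) r deficit′)) (≤-reflexive (heights h k))
  where
  deficit′ : suc (suc h + k) ≤ f j + sumFrom f (suc j) k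
  deficit′ = subst (λ x → suc x ≤ f j + sumFrom f (suc j) k) (+-suc h k) deficit
  heights : ∀ h k → suc (suc h + (k + k)) ≡ h + (suc k + suc k)
  heights = solve-∀

ℓ-staircase : ∀ f p k r → suc k ≤ sumFrom f (suc p) (suc k) → ℓ (staircase f 1 (suc p + (k + r))) (suc p) ≤ k + k
ℓ-staircase f p k r enough = begin
  ℓ (staircase f 1 (suc p + (k + r))) (suc p)
    ≡⟨ cong (matchedLen 0) (afterUp-staircase f 1 p (k + r)) ⟩
  matchedLen 0 (replicate (f (suc p)) d ++ staircase f (suc (suc p)) (k + r))
    ≡⟨ cong (λ w → matchedLen 0 (replicate (f (suc p)) d ++ w)) (staircase-++ f (suc (suc p)) k r) ⟩
  matchedLen 0 (replicate (f (suc p)) d ++ staircase f (suc (suc p)) k ++ staircase f (k + suc (suc p)) r)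
    ≤⟨ matchedLen-staircase f k (f (suc p)) 0 (suc (suc p)) _ enough ⟩
  k + k
    ∎
  where open ≤-Reasoning

countRange : ℕ → ℕ → List (Maybe ℕ) → ℕ
countRange a k C = sumFrom (λ j → countJust j C) a k

InRange : ℕ → ℕ → ℕ → Set
InRange a b c = a ≤ c × c < b

countJust-++ : ∀ j xs ys → countJust j (xs ++ ys) ≡ countJust j xs + countJust j ys
countJust-++ j []             ys = refl
countJust-++ j (nothing ∷ xs) ys = countJust-++ j xs ys
countJust-++ j (just c ∷ xs)  ys with c ≟ j
... | yes _ = cong suc (countJust-++ j xs ys)
... | no  _ = countJust-++ j xs ys

countRange-++ : ∀ a k xs ys → countRange a k (xs ++ ys) ≡ countRange a k xs + countRange a k ys
countRange-++ a zero    xs ys = refl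
countRange-++ a (suc k) xs ys
  rewrite countJust-++ a xs ys | countRange-++ (suc a) k xs ys =
  interchange (countJust a xs) (countJust a ys) (countRange (suc a) k xs) (countRange (suc a) k ys)

countRange-infix : ∀ a k xs ys zs → countRange a k ys ≤ countRange a k (xs ++ ys ++ zs)
countRange-infix a k xs ys zs = begin
  countRange a k ys                                              ≤⟨ m≤m+n _ _ ⟩
  countRange a k ys + countRange a k zs                          ≤⟨ m≤n+m _ (countRange a k xs) ⟩
  countRange a k xs + (countRange a k ys + countRange a k zs)    ≡⟨ cong (_ +_) (countRange-++ a k ys zs) ⟨
  countRange a k xs + countRange a k (ys ++ zs)                  ≡⟨ countRange-++ a k xs (ys ++ zs) ⟨
  countRange a k (xs ++ ys ++ zs)                                ∎
  where open ≤-Reasoning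

countJust-absent : ∀ j C → All (MaybeAll.All (_≢ j)) C → countJust j C ≡ 0
countJust-absent j []             []                     = refl
countJust-absent j (nothing ∷ C)  (_ ∷ absent)           = countJust-absent j C absent
countJust-absent j (just c ∷ C)   (MaybeAll.just c≢j ∷ absent) with c ≟ j
... | yes c≡j = contradiction c≡j c≢j
... | no  _   = countJust-absent j C absent

countRange-below : ∀ a k C → All (MaybeAll.All (_< a)) C → countRange a k C ≡ 0
countRange-below a zero    C below = refl
countRange-below a (suc k) C below
  rewrite countJust-absent a C (All.map (MaybeAll.map <⇒≢) below) =
  countRange-below (suc a) k C (All.map (MaybeAll.map (λ c<a → ≤-trans c<a (n≤1+n a))) below)

countRange-singleton-≤1 : ∀ a k m → countRange a k (m ∷ []) ≤ 1
countRange-singleton-≤1 a zero    m        = z≤n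
countRange-singleton-≤1 a (suc k) nothing  = countRange-singleton-≤1 (suc a) k nothing
countRange-singleton-≤1 a (suc k) (just c) with c ≟ a
... | yes refl = s≤s (≤-reflexive (countRange-below (suc a) k (just a ∷ []) (MaybeAll.just ≤-refl ∷ [])))
... | no  _    = countRange-singleton-≤1 (suc a) k (just c)

countRange-singleton-≥1 : ∀ a k {m} → MaybeAny.Any (InRange a (a + k)) m → 1 ≤ countRange a k (m ∷ [])
countRange-singleton-≥1 a zero    (MaybeAny.just (a≤c , c<a+0)) =
  contradiction (subst (_ <_) (+-identityʳ a) c<a+0) (≤⇒≯ a≤c)
countRange-singleton-≥1 a (suc k) {just c} (MaybeAny.just (a≤c , c<a+1+k)) with c ≟ a
... | yes _   = s≤s z≤n
... | no  c≢a = countRange-singleton-≥1 (suc a) k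
                  (MaybeAny.just (≤∧≢⇒< a≤c (c≢a ∘ sym) , subst (c <_) (+-suc a k) c<a+1+k))

length≤countRange : ∀ a k C → All (MaybeAny.Any (InRange a (a + k))) C → length C ≤ countRange a k C
length≤countRange a k []      []              = z≤n
length≤countRange a k (m ∷ C) (inRange ∷ rest) =
  subst (suc (length C) ≤_) (sym (countRange-++ a k (m ∷ []) C))
    (+-mono-≤ (countRange-singleton-≥1 a k inRange) (length≤countRange a k C rest))

-- Entry i (from 0), if present, is at least q + i: a certificate never precedes its node.
NotBefore : ℕ → List (Maybe ℕ) → Set
NotBefore q []      = ⊤
NotBefore q (m ∷ C) = MaybeAll.All (q ≤_) m × NotBefore (suc q) C

NotBefore⇒All : ∀ q C → NotBefore q C → All (MaybeAll.All (q ≤_)) C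
NotBefore⇒All q []      tt            = []
NotBefore⇒All q (m ∷ C) (q≤m , rest) =
  q≤m ∷ All.map (MaybeAll.map (≤-trans (n≤1+n q))) (NotBefore⇒All (suc q) C rest)

countRange-NotBefore : ∀ q k C → NotBefore q C → countRange q k C ≤ k
countRange-NotBefore q zero    C       _              = z≤n
countRange-NotBefore q (suc k) []      _              = ≤-trans (countRange-NotBefore (suc q) k [] tt) (n≤1+n k)
countRange-NotBefore q (suc k) (m ∷ C) (_ , notBefore) = begin
  countRange q (suc k) (m ∷ C)
    ≡⟨ countRange-++ q (suc k) (m ∷ []) C ⟩
  countRange q (suc k) (m ∷ []) + (countJust q C + countRange (suc q) k C)
    ≡⟨ cong (λ x → countRange q (suc k) (m ∷ []) + (x + countRange (suc q) k C)) noneAt-q ⟩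
  countRange q (suc k) (m ∷ []) + countRange (suc q) k C
    ≤⟨ +-mono-≤ (countRange-singleton-≤1 q (suc k) m) (countRange-NotBefore (suc q) k C notBefore) ⟩
  suc k
    ∎
  where
  open ≤-Reasoning
  noneAt-q : countJust q C ≡ 0
  noneAt-q = countJust-absent q C
    (All.map (MaybeAll.map (λ q<c → <⇒≢ q<c ∘ sym)) (NotBefore⇒All (suc q) C notBefore))

sizeF : List LTree → ℕ
sizeF ts = length (labelsF ts)

sizeF-∷ : ∀ t ts → sizeF (t ∷ ts) ≡ size t + sizeF ts
sizeF-∷ t ts = length-++ (labels t)

mutual
  length-subs : ∀ dp t → length (subs dp t) ≡ size t
  length-subs dp (node _ ts) = cong suc (length-subsF (suc dp) ts)

  length-subsF : ∀ dp ts → length (subsF dp ts) ≡ sizeF ts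
  length-subsF dp []       = refl
  length-subsF dp (t ∷ ts) = begin
    length (subs dp t ++ subsF dp ts)           ≡⟨ length-++ (subs dp t) ⟩
    length (subs dp t) + length (subsF dp ts)   ≡⟨ cong₂ _+_ (length-subs dp t) (length-subsF dp ts) ⟩
    size t + sizeF ts                           ≡⟨ sizeF-∷ t ts ⟨
    sizeF (t ∷ ts)                              ∎
    where open ≡-Reasoning

DepthAtLeast : ℕ → ℕ × LTree → Set
DepthAtLeast k (dp , _) = k ≤ dp

mutual
  subs-DepthAtLeast : ∀ dp t → All (DepthAtLeast dp) (subs dp t)
  subs-DepthAtLeast dp (node _ ts) =
    ≤-refl ∷ All.map (≤-trans (n≤1+n dp)) (subsF-DepthAtLeast (suc dp) ts)

  subsF-DepthAtLeast : ∀ dp ts → All (DepthAtLeast dp) (subsF dp ts)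
  subsF-DepthAtLeast dp []       = []
  subsF-DepthAtLeast dp (t ∷ ts) = ++⁺ (subs-DepthAtLeast dp t) (subsF-DepthAtLeast dp ts)

HasCertificate : ℕ × LTree → Set
HasCertificate (dp , t) = MaybeAny.Any (_< size t) (firstBelow dp (labels t))

firstBelow-< : ∀ b xs → Any (_< b) xs → MaybeAny.Any (_< length xs) (firstBelow b xs)
firstBelow-< b (x ∷ xs) (here x<b) with suc x ≤? b
... | yes _   = MaybeAny.just (s≤s z≤n)
... | no  x≮b = contradiction x<b x≮b
firstBelow-< b (x ∷ xs) (there below) with suc x ≤? b
... | yes _ = MaybeAny.just (s≤s z≤n)
... | no  _ with firstBelow b xs | firstBelow-< b xs below
...   | just o | MaybeAny.just o<length = MaybeAny.just (s≤s o<length)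

StickyAt⇒HasCertificate : ∀ {w} → StickyAt w → DepthAtLeast 1 w → HasCertificate w
StickyAt⇒HasCertificate {dp , t} (_ , someBelow , _) 1≤dp = firstBelow-< dp (labels t) (someBelow 1≤dp)

certificate-InRange : ∀ q {n m} → MaybeAny.Any (_< n) m → MaybeAny.Any (InRange q (q + n)) (Data.Maybe.map (q +_) m)
certificate-InRange q (MaybeAny.just o<n) = MaybeAny.just (m≤m+n q _ , +-monoʳ-< q o<n)

length-certsFrom : ∀ q N → length (certsFrom q N) ≡ length N
length-certsFrom q []      = refl
length-certsFrom q (_ ∷ N) = cong suc (length-certsFrom (suc q) N)

certsFrom-++ : ∀ q xs ys → certsFrom q (xs ++ ys) ≡ certsFrom q xs ++ certsFrom (q + length xs) ys
certsFrom-++ q []       ys = cong (λ i → certsFrom i ys) (sym (+-identityʳ q))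
certsFrom-++ q (x ∷ xs) ys = cong (_ ∷_) (trans (certsFrom-++ (suc q) xs ys)
  (cong (λ i → certsFrom (suc q) xs ++ certsFrom i ys) (sym (+-suc q (length xs)))))

certsFrom-NotBefore : ∀ q N → NotBefore q (certsFrom q N)
certsFrom-NotBefore q []            = tt
certsFrom-NotBefore q ((dp , t) ∷ N) =
  MaybeAll.map⁺ (MaybeAll.universal (m≤m+n q) (firstBelow dp (labels t))) , certsFrom-NotBefore (suc q) N

widen : ∀ {a b a′ b′} → a′ ≤ a → b ≤ b′ → InRange a b ⊆ InRange a′ b′
widen a′≤a b≤b′ (a≤c , c<b) = ≤-trans a′≤a a≤c , ≤-trans c<b b≤b′

mutual
  certsFrom-subs-InRange : ∀ q dp t → All HasCertificate (subs dp t) →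
    All (MaybeAny.Any (InRange q (q + size t))) (certsFrom q (subs dp t))
  certsFrom-subs-InRange q dp (node _ ts) (hasCert ∷ rest) =
    certificate-InRange q hasCert
    ∷ All.map (MaybeAny.map (widen (n≤1+n q) (≤-reflexive (sym (+-suc q (sizeF ts))))))
        (certsFrom-subsF-InRange (suc q) (suc dp) ts rest)

  certsFrom-subsF-InRange : ∀ q dp ts → All HasCertificate (subsF dp ts) →
    All (MaybeAny.Any (InRange q (q + sizeF ts))) (certsFrom q (subsF dp ts))
  certsFrom-subsF-InRange q dp []       [] = []
  certsFrom-subsF-InRange q dp (t ∷ ts) certified
    rewrite certsFrom-++ q (subs dp t) (subsF dp ts) | length-subs dp t =
    ++⁺ (All.map (MaybeAny.map (widen ≤-refl first≤))
          (certsFrom-subs-InRange q dp t (++⁻ˡ (subs dp t) certified)))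
        (All.map (MaybeAny.map (widen (m≤m+n q (size t)) rest≤))
          (certsFrom-subsF-InRange (q + size t) dp ts (++⁻ʳ (subs dp t) certified)))
    where
    first≤ : q + size t ≤ q + sizeF (t ∷ ts)
    first≤ = +-monoʳ-≤ q (≤-trans (m≤m+n (size t) (sizeF ts)) (≤-reflexive (sym (sizeF-∷ t ts))))
    rest≤ : q + size t + sizeF ts ≤ q + sizeF (t ∷ ts)
    rest≤ = ≤-reflexive (trans (+-assoc q _ _) (cong (q +_) (sym (sizeF-∷ t ts))))

-- All |S_w| certificates of the nodes of S_w lie within S_w.
countRange-subtree : ∀ B dep t A → All HasCertificate (subs dep t) →
  size t ≤ countRange (suc (length B)) (size t) (certsFrom 1 (B ++ subs dep t ++ A))
countRange-subtree B dep t A certified = begin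
  size t
    ≡⟨ trans (length-certsFrom q (subs dep t)) (length-subs dep t) ⟨
  length (certsFrom q (subs dep t))
    ≤⟨ length≤countRange q (size t) _ (certsFrom-subs-InRange q dep t certified) ⟩
  countRange q (size t) (certsFrom q (subs dep t))
    ≤⟨ countRange-infix q (size t) (certsFrom 1 B) _ (certsFrom (q + length (subs dep t)) A) ⟩
  countRange q (size t) (certsFrom 1 B ++ certsFrom q (subs dep t) ++ certsFrom (q + length (subs dep t)) A)
    ≡⟨ cong (countRange q (size t)) certsFrom-split ⟨
  countRange q (size t) (certsFrom 1 (B ++ subs dep t ++ A))
    ∎
  where
  open ≤-Reasoning
  q : ℕ
  q = suc (length B)
  certsFrom-split : certsFrom 1 (B ++ subs dep t ++ A)
                  ≡ certsFrom 1 B ++ certsFrom q (subs dep t) ++ certsFrom (q + length (subs dep t)) A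
  certsFrom-split = trans (certsFrom-++ 1 B (subs dep t ++ A))
                          (cong (certsFrom 1 B ++_) (certsFrom-++ q (subs dep t) A))

mutual
  matchedLen-contour : ∀ h t r → matchedLen h (contour t ++ r) ≡ length (contour t) + matchedLen h r
  matchedLen-contour h (node _ ts) r = matchedLen-contourF h ts r

  matchedLen-contourF : ∀ h ts r → matchedLen h (contourF ts ++ r) ≡ length (contourF ts) + matchedLen h r
  matchedLen-contourF h []       r = refl
  matchedLen-contourF h (t ∷ ts) r
    rewrite ++-assoc (contour t) (d ∷ contourF ts) r
          | matchedLen-contour (suc h) t (d ∷ contourF ts ++ r)
          | matchedLen-contourF h ts r
          | length-++ (contour t) {d ∷ contourF ts}
    = regroup (length (contour t)) (length (contourF ts)) (matchedLen h r)
    where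
    regroup : ∀ a b x → suc (a + suc (b + x)) ≡ suc (a + suc b) + x
    regroup = solve-∀

length-contourF : ∀ ts → length (contourF ts) ≡ sizeF ts + sizeF ts
length-contourF []                = refl
length-contourF (node l cs ∷ ts)
  rewrite length-++ (contourF cs) {d ∷ contourF ts} | length-contourF cs | length-contourF ts
  = trans (regroup (sizeF cs) (sizeF ts)) (sym (cong₂ _+_ sizeF≡ sizeF≡))
  where
  sizeF≡ : sizeF (node l cs ∷ ts) ≡ size (node l cs) + sizeF ts
  sizeF≡ = sizeF-∷ (node l cs) ts
  regroup : ∀ a b → suc ((a + a) + suc (b + b)) ≡ (suc a + b) + (suc a + b)
  regroup = solve-∀

mutual
  DyckFrom-contour : ∀ h t r → DyckFrom h r → DyckFrom h (contour t ++ r)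
  DyckFrom-contour h (node _ ts) r dyck = DyckFrom-contourF h ts r dyck

  DyckFrom-contourF : ∀ h ts r → DyckFrom h r → DyckFrom h (contourF ts ++ r)
  DyckFrom-contourF h []       r dyck = dyck
  DyckFrom-contourF h (t ∷ ts) r dyck rewrite ++-assoc (contour t) (d ∷ contourF ts) r =
    DyckFrom-contour (suc h) t _ (DyckFrom-contourF h ts r dyck)

ups : List Step → ℕ
ups []      = 0
ups (u ∷ w) = suc (ups w)
ups (d ∷ w) = ups w

ups-++ : ∀ xs ys → ups (xs ++ ys) ≡ ups xs + ups ys
ups-++ []       ys = refl
ups-++ (u ∷ xs) ys = cong suc (ups-++ xs ys)
ups-++ (d ∷ xs) ys = ups-++ xs ys

ups-contourF : ∀ ts → ups (contourF ts) ≡ sizeF ts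
ups-contourF []               = refl
ups-contourF (node l cs ∷ ts)
  rewrite ups-++ (contourF cs) (d ∷ contourF ts) | ups-contourF cs | ups-contourF ts
  = sym (sizeF-∷ (node l cs) ts)

afterUp-after-ups : ∀ p P w → ups P ≡ p → afterUp (suc p) (P ++ u ∷ w) ≡ w
afterUp-after-ups .0              []      w refl = refl
afterUp-after-ups .(suc (ups P)) (u ∷ P) w refl = afterUp-after-ups (ups P) P w refl
afterUp-after-ups p              (d ∷ P) w ups≡p = afterUp-after-ups p P w ups≡p

-- The p-th node of a forest (from 0, in prefix order) is entered by the (p+1)-th up step of its contour.
record NodeAt (dp : ℕ) (ts : List LTree) (p : ℕ) : Set where
  constructor nodeAt
  field
    depth                   : ℕ
    subtree                 : LTree
    nodesBefore nodesAfter  : List (ℕ × LTree)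
    stepsBefore stepsAfter  : List Step
    nodes-split             : subsF dp ts ≡ nodesBefore ++ subs depth subtree ++ nodesAfter
    length-nodesBefore      : length nodesBefore ≡ p
    contour-split           : contourF ts ≡ stepsBefore ++ u ∷ contour subtree ++ d ∷ stepsAfter
    ups-stepsBefore         : ups stepsBefore ≡ p

nodeAt-root : ∀ dp t ts → NodeAt dp (t ∷ ts) 0
nodeAt-root dp t ts = nodeAt dp t [] (subsF dp ts) [] (contourF ts) refl refl refl refl

nodeAt-child : ∀ {dp l cs ts p} → NodeAt (suc dp) cs p → NodeAt dp (node l cs ∷ ts) (suc p)
nodeAt-child {dp} {l} {cs} {ts} (nodeAt dep t B A P Q nodes≡ refl contour≡ ups≡) =
  nodeAt dep t ((dp , node l cs) ∷ B) (A ++ subsF dp ts) (u ∷ P) (Q ++ d ∷ contourF ts)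
    (cong ((dp , node l cs) ∷_) (begin
      subsF (suc dp) cs ++ subsF dp ts          ≡⟨ cong (_++ subsF dp ts) nodes≡ ⟩
      (B ++ subs dep t ++ A) ++ subsF dp ts     ≡⟨ ++-assoc B _ _ ⟩
      B ++ (subs dep t ++ A) ++ subsF dp ts     ≡⟨ cong (B ++_) (++-assoc (subs dep t) A _) ⟩
      B ++ subs dep t ++ A ++ subsF dp ts       ∎))
    refl
    (cong (u ∷_) (begin
      contourF cs ++ d ∷ contourF ts                      ≡⟨ cong (_++ d ∷ contourF ts) contour≡ ⟩
      (P ++ u ∷ contour t ++ d ∷ Q) ++ d ∷ contourF ts    ≡⟨ ++-assoc P _ _ ⟩
      P ++ u ∷ (contour t ++ d ∷ Q) ++ d ∷ contourF ts    ≡⟨ cong (λ w → P ++ u ∷ w) (++-assoc (contour t) _ _) ⟩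
      P ++ u ∷ contour t ++ d ∷ Q ++ d ∷ contourF ts      ∎))
    (cong suc ups≡)
  where open ≡-Reasoning

nodeAt-later : ∀ {dp ts p} t → NodeAt dp ts p → NodeAt dp (t ∷ ts) (size t + p)
nodeAt-later {dp} {ts} t@(node _ cs) (nodeAt dep t′ B A P Q nodes≡ refl contour≡ ups≡) =
  nodeAt dep t′ (subs dp t ++ B) A (u ∷ contour t ++ d ∷ P) Q
    (trans (cong (subs dp t ++_) nodes≡) (sym (++-assoc (subs dp t) B _)))
    (trans (length-++ (subs dp t)) (cong (_+ length B) (length-subs dp t)))
    (cong (u ∷_) (trans (cong (λ w → contour t ++ d ∷ w) contour≡) (sym (++-assoc (contour t) (d ∷ P) _))))
    (cong suc (trans (ups-++ (contourF cs) (d ∷ P)) (cong₂ _+_ (ups-contourF cs) ups≡)))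

nodeAt-< : ∀ dp ts p → p < sizeF ts → NodeAt dp ts p
nodeAt-< dp (t ∷ ts)         zero    _ = nodeAt-root dp t ts
nodeAt-< dp (node l cs ∷ ts) (suc p) p< with p <? sizeF cs
... | yes p<cs = nodeAt-child (nodeAt-< (suc dp) cs p p<cs)
... | no  p≮cs =
  subst (NodeAt dp (node l cs ∷ ts)) (cong suc cs+o≡p) (nodeAt-later (node l cs) (nodeAt-< dp ts o o<ts))
  where
  o : ℕ
  o = p ∸ sizeF cs
  cs+o≡p : sizeF cs + o ≡ p
  cs+o≡p = m+[n∸m]≡n (≮⇒≥ p≮cs)
  o<ts : o < sizeF ts
  o<ts = +-cancelˡ-< (size (node l cs)) o (sizeF ts)
           (subst₂ _<_ (cong suc (sym cs+o≡p)) (sizeF-∷ (node l cs) ts) p<)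

E-path-IsDyck : ∀ t → IsDyck (E-path t)
E-path-IsDyck t = subst IsDyck (++-identityʳ (contour t)) (DyckFrom-contour 0 t [] refl)

E-path-length : ∀ l ts → length (E-path (node l ts)) ≡ 2 * sizeF ts
E-path-length l ts = trans (length-contourF ts) (cong (sizeF ts +_) (sym (+-identityʳ (sizeF ts))))

ℓ-E-path : ∀ l ts {dp p} (at : NodeAt dp ts p) → ℓ (E-path (node l ts)) (suc p) ≡ length (contour (NodeAt.subtree at))
ℓ-E-path l ts {p = p} (nodeAt _ t _ _ P Q _ _ contour≡ ups≡) = begin
  matchedLen 0 (afterUp (suc p) (contourF ts))                    ≡⟨ cong (matchedLen 0 ∘ afterUp (suc p)) contour≡ ⟩
  matchedLen 0 (afterUp (suc p) (P ++ u ∷ contour t ++ d ∷ Q))    ≡⟨ cong (matchedLen 0) (afterUp-after-ups p P _ ups≡) ⟩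
  matchedLen 0 (contour t ++ d ∷ Q)                               ≡⟨ matchedLen-contour 0 t (d ∷ Q) ⟩
  length (contour t) + 0                                          ≡⟨ +-identityʳ _ ⟩
  length (contour t)                                              ∎
  where open ≡-Reasoning

module _ (l : ℕ) (ts : List LTree) (certified : All HasCertificate (subsF 1 ts)) where

  private
    S : LTree
    S = node l ts
    C : List (Maybe ℕ)
    C = certificates S
    n : ℕ
    n = sizeF ts

  countRange-certificates : countRange 1 n C ≡ n
  countRange-certificates = ≤-antisym (countRange-NotBefore 1 n C (certsFrom-NotBefore 1 (subsF 1 ts)))
    (subst (_≤ countRange 1 n C) (trans (length-certsFrom 1 (subsF 1 ts)) (length-subsF 1 ts))
      (length≤countRange 1 n C (certsFrom-subsF-InRange 1 1 ts certified)))

  D-path-IsDyck : IsDyck (D-path S)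
  D-path-IsDyck = subst IsDyck (sym (D-from≡staircase S 1 n))
    (staircase-DyckFrom (cert-count S) 1 n 0
      (λ i → countRange-NotBefore 1 i C (certsFrom-NotBefore 1 (subsF 1 ts)))
      countRange-certificates)

  D-path-length : length (D-path S) ≡ 2 * n
  D-path-length = begin
    length (D-from S 1 n)                 ≡⟨ cong length (D-from≡staircase S 1 n) ⟩
    length (staircase (cert-count S) 1 n) ≡⟨ length-staircase (cert-count S) 1 n ⟩
    n + countRange 1 n C                  ≡⟨ cong (n +_) (trans countRange-certificates (sym (+-identityʳ n))) ⟩
    2 * n                                 ∎
    where open ≡-Reasoning

  ℓ-D-path : ∀ {p} (at : NodeAt 1 ts p) → ℓ (D-path S) (suc p) ≤ length (contour (NodeAt.subtree at))
  ℓ-D-path (nodeAt dep t@(node _ cs) B A _ _ nodes≡ refl _ _) = begin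
    ℓ (D-from S 1 n) (suc p)                                    ≡⟨ cong (λ w → ℓ w (suc p)) (D-from≡staircase S 1 n) ⟩
    ℓ (staircase (cert-count S) 1 n) (suc p)                    ≡⟨ cong (λ m → ℓ (staircase (cert-count S) 1 m) (suc p)) n≡ ⟩
    ℓ (staircase (cert-count S) 1 (suc p + (k + length A))) (suc p)
      ≤⟨ ℓ-staircase (cert-count S) p k (length A) enough ⟩
    k + k                                                       ≡⟨ length-contourF cs ⟨
    length (contourF cs)                                        ∎
    where
    open ≤-Reasoning
    p k : ℕ
    p = length B
    k = sizeF cs
    n≡ : n ≡ suc p + (k + length A)
    n≡ = begin-equality
      n                                          ≡⟨ length-subsF 1 ts ⟨
      length (subsF 1 ts)                        ≡⟨ cong length nodes≡ ⟩
      length (B ++ subs dep t ++ A)              ≡⟨ length-++ B ⟩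
      p + length (subs dep t ++ A)               ≡⟨ cong (p +_) (length-++ (subs dep t)) ⟩
      p + (length (subs dep t) + length A)       ≡⟨ cong (λ m → p + (m + length A)) (length-subs dep t) ⟩
      p + suc (k + length A)                     ≡⟨ +-suc p _ ⟩
      suc p + (k + length A)                     ∎
    enough : suc k ≤ countRange (suc p) (suc k) C
    enough = subst (λ N → suc k ≤ countRange (suc p) (suc k) (certsFrom 1 N)) (sym nodes≡)
      (countRange-subtree B dep t A (++⁻ˡ (subs dep t) (++⁻ʳ B (subst (All HasCertificate) nodes≡ certified))))

proposition4p1 : (n : ℕ) (S : LTree) → Sticky S → size S ≡ suc n →
    TamariInterval n (D-path S) (E-path S)
proposition4p1 .(sizeF ts) (node l ts) (_ ∷ sticky) refl =
  (D-path-IsDyck l ts certified , D-path-length l ts certified) ,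
  (E-path-IsDyck (node l ts) , E-path-length l ts) ,
  ℓ-D≤ℓ-E
  where
  certified : All HasCertificate (subsF 1 ts)
  certified = All.zipWith (λ (isSticky , deep) → StickyAt⇒HasCertificate isSticky deep)
                          (sticky , subsF-DepthAtLeast 1 ts)
  ℓ-D≤ℓ-E : ∀ i → 1 ≤ i → i ≤ sizeF ts → ℓ (D-path (node l ts)) i ≤ ℓ (E-path (node l ts)) i
  ℓ-D≤ℓ-E (suc p) _ p<n = let at = nodeAt-< 1 ts p p<n in
    ≤-trans (ℓ-D-path l ts certified at) (≤-reflexive (sym (ℓ-E-path l ts at)))
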